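{- Let $G$ be an abelian group and let $\mathcal A=(A_1,\dots,A_q)$ be a tuple of finite nonempty subsets of $G$ with $|A_i|=k_i$ for $1\le i\le q$. Then for every $r\in\mathbb N$ and every $\mathbf h\in\mathbb N_0^q$ there exists a set $X_{\mathbf h}\subseteq G$ such that $(r\mathbf h)\cdot\mathcal A\subseteq X_{\mathbf h}+\mathbf h\cdot\mathcal A$ and \[ |X_{\mathbf h}|\le\prod_{i=1}^q\binom{(r+1)(k_i-1)}{k_i-1}. \] In particular, $\mathcal A$ is a chromatic $(r,\ell)$-approximate group with $\ell=\prod_{i=1}^q\binom{(r+1)(k_i-1)}{k_i-1}$.
   Context: $\mathbb N=\{1,2,\dots\}$, $\mathbb N_0=\{0,1,2,\dots\}$. For subsets $X,Y$ of an abelian group, $X+Y=\{x+y:x\in X,y\in Y\}$; for $h\in\mathbb N$, $hA$ is the $h$-fold sumset $A+\cdots+A$ and $0A=\{0\}$. For $\mathbf h=(h_1,\dots,h_q)\in\mathbb N_0^q$, $\mathbf h\cdot\mathcal A=h_1A_1+\cdots+h_qA_q$ and $r\mathbf h=(rh_1,\dots,rh_q)$. A tuple $\mathcal A$ is a chromatic $(r,\ell)$-approximate group if for every $\mathbf h\in\mathbb N_0^q$ there is $X_{\mathbf h}\subseteq G$ with $|X_{\mathbf h}|\le\ell$ and $(r\mathbf h)\cdot\mathcal A\subseteq X_{\mathbf h}+\mathbf h\cdot\mathcal A$. -}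

module Defs where

open import Level using (Level; _⊔_)
open import Data.Nat using (ℕ; zero; suc; _*_; _∸_; _≤_)
open import Data.Nat.Combinatorics using (_C_)
open import Data.Fin using (Fin; zero; suc)
open import Data.List using (List; length)
open import Data.Vec using (Vec; foldr)
open import Data.Vec.Relation.Unary.All using (All)
open import Data.Product using (Σ; ∃; _×_)
open import Algebra.Bundles using (AbelianGroup)
import Data.List.Membership.Setoid as SetoidMembership

∏ : (q : ℕ) → (Fin q → ℕ) → ℕ
∏ zero    f = 1
∏ (suc q) f = f zero * ∏ q (λ i → f (suc i))

module Sumsets {c ℓ : Level} (G : AbelianGroup c ℓ) where
  open AbelianGroup G
  open SetoidMembership setoid public using (_∈_)

  -- Finite subsets of G are represented by lists of elements
  -- (membership up to the group's equality _≈_).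

  -- Sum of a vector of group elements (empty sum = ε, so 0A = {0}).
  vsum : {n : ℕ} → Vec Carrier n → Carrier
  vsum = foldr _ _∙_ ε

  Σᶠ : (q : ℕ) → (Fin q → Carrier) → Carrier
  Σᶠ zero    g = ε
  Σᶠ (suc q) g = g zero ∙ Σᶠ q (λ i → g (suc i))

  -- x ∈ h·𝒜 = h₁A₁ + ⋯ + h_qA_q : x is (≈) a sum over i of h_i elements of A_i.
  InMultiSum : (q : ℕ) → (Fin q → ℕ) → (Fin q → List Carrier) → Carrier → Set (c ⊔ ℓ)
  InMultiSum q h 𝒜 x =
    Σ ((i : Fin q) → Vec Carrier (h i)) λ a →
      ((i : Fin q) → All (_∈ 𝒜 i) (a i)) × (Σᶠ q (λ i → vsum (a i)) ≈ x)

  scale : {q : ℕ} → ℕ → (Fin q → ℕ) → (Fin q → ℕ)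
  scale r h i = r * h i

  ⊆Translates : {p : Level} → (Carrier → Set p) → List Carrier → (Carrier → Set p) → Set (c ⊔ ℓ ⊔ p)
  ⊆Translates Y X Z = ∀ y → Y y → ∃ λ x → ∃ λ z → x ∈ X × Z z × (y ≈ x ∙ z)

  -- 𝒜 is a chromatic (r, ℓ')-approximate group: for every 𝐡 ∈ ℕ₀^q there is
  -- X_𝐡 ⊆ G with |X_𝐡| ≤ ℓ' and (r𝐡)·𝒜 ⊆ X_𝐡 + 𝐡·𝒜.
  -- (A list of length ≤ ℓ' represents a set of size ≤ ℓ'; conversely any such set
  -- can be listed without repetition.)
  ChromaticApproxGroup : (q : ℕ) → (Fin q → List Carrier) → ℕ → ℕ → Set (c ⊔ ℓ)
  ChromaticApproxGroup q 𝒜 r ℓ' =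
    (h : Fin q → ℕ) → Σ (List Carrier) λ X →
      (length X ≤ ℓ') ×
      ⊆Translates (InMultiSum q (scale r h) 𝒜) X (InMultiSum q h 𝒜)

bound : (q : ℕ) → (Fin q → ℕ) → ℕ → ℕ
bound q k r = ∏ q (λ i → (suc r * (k i ∸ 1)) C (k i ∸ 1))

-- Write an element of (r h)A, A = b ∷ B with d = |B|, through its multiplicities (c₀, c),
-- c ∈ ℕᵈ.  Put nⱼ = ⌊d cⱼ / (h+1)⌋ and fⱼ = ⌈(h+1) nⱼ / d⌉.  Then fⱼ ≤ cⱼ and d (cⱼ − fⱼ) ≤ h,
-- so the excess e = c − f has |e| ≤ h and, padded with copies of b, is an element of hA.  What
-- remains, (r−1)h b + Σⱼ fⱼ (Bⱼ − b), depends only on n, and |n| ≤ r d leaves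
-- ((r+1)d choose d) possibilities.  For a tuple of sets the translate sets add, so their
-- sizes multiply.
module Submission where

open import Defs
open import Level using (Level; _⊔_)
open import Algebra.Bundles using (AbelianGroup)
open import Data.Empty using (⊥-elim)
open import Data.Fin using (Fin; zero; suc)
open import Function using (_∘_)
open import Data.Nat using (ℕ; zero; suc; pred; _+_; _*_; _∸_; _≤_; _<_; s≤s; s≤s⁻¹; z≤n; NonZero)
open import Data.Nat.Properties
open import Data.Nat.DivMod using (_/_; _%_; m≡m%n+[m/n]*n; m%n<n; m/n*n≤m; m<n*o⇒m/o<n)
open import Data.Nat.Combinatorics using (_C_; nCn≡1; nCk+nC[k+1]≡[n+1]C[k+1])
open import Data.List using (List; []; _∷_; length; _++_; cartesianProductWith)
import Data.List as List
open import Data.List.Properties using (length-++; length-map)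
open import Data.List.Relation.Unary.Any using (here; there)
open import Data.List.Relation.Unary.Unique.Setoid using (Unique)
open import Data.List.Membership.Propositional using () renaming (_∈_ to _∈ₚ_)
open import Data.List.Membership.Propositional.Properties using (∈-map⁺; ∈-++⁺ˡ; ∈-++⁺ʳ)
import Data.List.Membership.Setoid.Properties as SetoidMembership
open import Data.Vec using (Vec; []; _∷_; sum; zipWith; replicate)
import Data.Vec as Vec
import Data.Vec.Relation.Unary.All as All
open All using (All; []; _∷_)
open import Data.Product using (Σ; ∃; ∃₂; _×_; _,_; proj₁; proj₂)
open import Relation.Binary.PropositionalEquality using (_≡_; _≢_; cong; cong₂; subst; module ≡-Reasoning)
import Relation.Binary.PropositionalEquality as ≡
open import Algebra.Properties.CommutativeSemigroup +-commutativeSemigroup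
  using () renaming (interchange to +-interchange)
open import Algebra.Properties.CommutativeSemigroup *-commutativeSemigroup
  using () renaming (xy∙z≈xz∙y to *-rightComm)

sum-zipWith-+ : ∀ {m} (u v : Vec ℕ m) → sum (zipWith _+_ u v) ≡ sum u + sum v
sum-zipWith-+ []      []      = ≡.refl
sum-zipWith-+ (x ∷ u) (y ∷ v) =
  ≡.trans (cong (x + y +_) (sum-zipWith-+ u v)) (+-interchange x y (sum u) (sum v))

sum-replicate-0 : ∀ m → sum (replicate m 0) ≡ 0
sum-replicate-0 zero    = ≡.refl
sum-replicate-0 (suc m) = sum-replicate-0 m

length-cartesianProductWith : ∀ {a b c} {A : Set a} {B : Set b} {C : Set c}
  (f : A → B → C) xs ys → length (cartesianProductWith f xs ys) ≡ length xs * length ys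
length-cartesianProductWith f []       ys = ≡.refl
length-cartesianProductWith f (x ∷ xs) ys = begin
  length (List.map (f x) ys ++ cartesianProductWith f xs ys)
    ≡⟨ length-++ (List.map (f x) ys) ⟩
  length (List.map (f x) ys) + length (cartesianProductWith f xs ys)
    ≡⟨ cong₂ _+_ (length-map (f x) ys) (length-cartesianProductWith f xs ys) ⟩
  length ys + length xs * length ys
    ∎
  where open ≡-Reasoning

⌈_/_⌉ : ℕ → (n : ℕ) .{{_ : NonZero n}} → ℕ
⌈ m / n ⌉ = (m + pred n) / n

m<[1+m/n]*n : ∀ m n .{{_ : NonZero n}} → m < suc (m / n) * n
m<[1+m/n]*n m n = begin-strict
  m                   ≡⟨ m≡m%n+[m/n]*n m n ⟩
  m % n + (m / n) * n <⟨ +-monoˡ-< _ (m%n<n m n) ⟩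
  n + (m / n) * n     ∎
  where open ≤-Reasoning

m≤⌈m/n⌉*n : ∀ m n .{{_ : NonZero n}} → m ≤ ⌈ m / n ⌉ * n
m≤⌈m/n⌉*n m n@(suc k) = +-cancelʳ-≤ k m _ (begin
  m + k                       ≡⟨ m≡m%n+[m/n]*n (m + k) n ⟩
  (m + k) % n + ⌈ m / n ⌉ * n ≤⟨ +-monoˡ-≤ _ (s≤s⁻¹ (m%n<n (m + k) n)) ⟩
  k + ⌈ m / n ⌉ * n           ≡⟨ +-comm k _ ⟩
  ⌈ m / n ⌉ * n + k           ∎)
  where open ≤-Reasoning

⌈m/n⌉≤o : ∀ {m o} n .{{_ : NonZero n}} → m ≤ o * n → ⌈ m / n ⌉ ≤ o
⌈m/n⌉≤o {m} {o} n@(suc k) m≤o*n = s≤s⁻¹ (m<n*o⇒m/o<n (s≤s (begin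
  m + k     ≤⟨ +-monoˡ-≤ k m≤o*n ⟩
  o * n + k ≡⟨ +-comm (o * n) k ⟩
  k + o * n ∎)))
  where open ≤-Reasoning

-- Dividing by h + 1 rather than h avoids the case h = 0 and still yields excess c * d < h + 1.
module Rounding (h d : ℕ) .{{_ : NonZero d}} where

  cell : ℕ → ℕ
  cell c = c * d / suc h

  corner : ℕ → ℕ
  corner n = ⌈ n * suc h / d ⌉

  excess : ℕ → ℕ
  excess c = c ∸ corner (cell c)

  corner-cell≤ : ∀ c → corner (cell c) ≤ c
  corner-cell≤ c = ⌈m/n⌉≤o d (m/n*n≤m (c * d) (suc h))

  excess*d≤h : ∀ c → excess c * d ≤ h
  excess*d≤h c = s≤s⁻¹ (begin-strict
    (c ∸ f) * d   ≡⟨ *-distribʳ-∸ d c f ⟩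
    c * d ∸ f * d <⟨ m<n+o⇒m∸n<o (c * d) (f * d) c*d<f*d+1+h ⟩
    suc h         ∎)
    where
    open ≤-Reasoning
    f = corner (cell c)
    c*d<f*d+1+h : c * d < f * d + suc h
    c*d<f*d+1+h = begin-strict
      c * d                  <⟨ m<[1+m/n]*n (c * d) (suc h) ⟩
      suc h + cell c * suc h ≤⟨ +-monoʳ-≤ (suc h) (m≤⌈m/n⌉*n (cell c * suc h) d) ⟩
      suc h + f * d          ≡⟨ +-comm (suc h) (f * d) ⟩
      f * d + suc h          ∎

  corner+excess : ∀ {m} (c : Vec ℕ m) →
    c ≡ zipWith _+_ (Vec.map corner (Vec.map cell c)) (Vec.map excess c)
  corner+excess []      = ≡.refl
  corner+excess (x ∷ c) = cong₂ _∷_ (≡.sym (m+[n∸m]≡n (corner-cell≤ x))) (corner+excess c)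

  sum-cell*[1+h]≤sum*d : ∀ {m} (c : Vec ℕ m) → sum (Vec.map cell c) * suc h ≤ sum c * d
  sum-cell*[1+h]≤sum*d []      = z≤n
  sum-cell*[1+h]≤sum*d (x ∷ c) = begin
    (cell x + sum (Vec.map cell c)) * suc h       ≡⟨ *-distribʳ-+ (suc h) (cell x) _ ⟩
    cell x * suc h + sum (Vec.map cell c) * suc h ≤⟨ +-mono-≤ (m/n*n≤m (x * d) (suc h))
                                                              (sum-cell*[1+h]≤sum*d c) ⟩
    x * d + sum c * d                             ≡⟨ *-distribʳ-+ d x (sum c) ⟨
    (x + sum c) * d                               ∎
    where open ≤-Reasoning

  sum-excess*d≤m*h : ∀ {m} (c : Vec ℕ m) → sum (Vec.map excess c) * d ≤ m * h
  sum-excess*d≤m*h []              = z≤n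
  sum-excess*d≤m*h {suc m} (x ∷ c) = begin
    (excess x + sum (Vec.map excess c)) * d   ≡⟨ *-distribʳ-+ d (excess x) _ ⟩
    excess x * d + sum (Vec.map excess c) * d ≤⟨ +-mono-≤ (excess*d≤h x) (sum-excess*d≤m*h c) ⟩
    h + m * h                                 ∎
    where open ≤-Reasoning

simplex : (d M : ℕ) → List (Vec ℕ d)
simplex zero    M       = [] ∷ []
simplex (suc d) zero    = replicate (suc d) 0 ∷ []
simplex (suc d) (suc M) =
  List.map (0 ∷_) (simplex d (suc M)) ++ List.map incrementHead (simplex (suc d) M)
  where
  incrementHead : Vec ℕ (suc d) → Vec ℕ (suc d)
  incrementHead (x ∷ n) = suc x ∷ n

length-simplex : ∀ d M → length (simplex d M) ≡ (M + d) C d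
length-simplex zero    M       = ≡.refl
length-simplex (suc d) zero    = ≡.sym (nCn≡1 (suc d))
length-simplex (suc d) (suc M) = begin
  length (List.map (0 ∷_) (simplex d (suc M)) ++ List.map _ (simplex (suc d) M))
    ≡⟨ length-++ (List.map (0 ∷_) (simplex d (suc M))) ⟩
  length (List.map (0 ∷_) (simplex d (suc M))) + length (List.map _ (simplex (suc d) M))
    ≡⟨ cong₂ _+_ (length-map _ (simplex d (suc M))) (length-map _ (simplex (suc d) M)) ⟩
  length (simplex d (suc M)) + length (simplex (suc d) M)
    ≡⟨ cong₂ _+_ (length-simplex d (suc M)) (length-simplex (suc d) M) ⟩
  (suc M + d) C d + (M + suc d) C suc d
    ≡⟨ cong (λ n → n C d + (M + suc d) C suc d) (+-suc M d) ⟨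
  (M + suc d) C d + (M + suc d) C suc d
    ≡⟨ nCk+nC[k+1]≡[n+1]C[k+1] (M + suc d) d ⟩
  suc (M + suc d) C suc d
    ∎
  where open ≡-Reasoning

sum≤0⇒≡replicate : ∀ {d} (n : Vec ℕ d) → sum n ≤ 0 → n ≡ replicate d 0
sum≤0⇒≡replicate []         _   = ≡.refl
sum≤0⇒≡replicate (zero ∷ n) Σ≤0 = cong (0 ∷_) (sum≤0⇒≡replicate n Σ≤0)

∈-simplex : ∀ {d M} (n : Vec ℕ d) → sum n ≤ M → n ∈ₚ simplex d M
∈-simplex {zero}  {M}     []          _        = here ≡.refl
∈-simplex {suc d} {zero}  n           Σ≤0      = here (sum≤0⇒≡replicate n Σ≤0)
∈-simplex {suc d} {suc M} (zero ∷ n)  Σ≤M      = ∈-++⁺ˡ (∈-map⁺ (0 ∷_) (∈-simplex n Σ≤M))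
∈-simplex {suc d} {suc M} (suc x ∷ n) (s≤s Σ≤M) = ∈-++⁺ʳ _ (∈-map⁺ _ (∈-simplex (x ∷ n) Σ≤M))

gridPoint : (h d : ℕ) → Vec ℕ d → Vec ℕ d
gridPoint h zero    [] = []
gridPoint h (suc d) n  = Vec.map (Rounding.corner h (suc d)) n

grid-approximation : ∀ r h d (c : Vec ℕ d) → sum c ≤ r * h →
  ∃₂ λ n e → n ∈ₚ simplex d (r * d) × c ≡ zipWith _+_ (gridPoint h d n) e × sum e ≤ h
grid-approximation r h zero      []  _     = [] , [] , here ≡.refl , ≡.refl , z≤n
grid-approximation r h d@(suc _) c Σc≤rh =
  Vec.map cell c , Vec.map excess c , ∈-simplex _ Σn≤rd , corner+excess c , Σe≤h
  where
  open Rounding h d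
  open ≤-Reasoning
  Σn≤rd : sum (Vec.map cell c) ≤ r * d
  Σn≤rd = *-cancelʳ-≤ _ _ (suc h) (begin
    sum (Vec.map cell c) * suc h ≤⟨ sum-cell*[1+h]≤sum*d c ⟩
    sum c * d                    ≤⟨ *-monoˡ-≤ d Σc≤rh ⟩
    r * h * d                    ≡⟨ *-rightComm r h d ⟩
    r * d * h                    ≤⟨ *-monoʳ-≤ (r * d) (n≤1+n h) ⟩
    r * d * suc h                ∎)
  Σe≤h : sum (Vec.map excess c) ≤ h
  Σe≤h = *-cancelʳ-≤ _ _ d (begin
    sum (Vec.map excess c) * d ≤⟨ sum-excess*d≤m*h c ⟩
    d * h                      ≡⟨ *-comm d h ⟩
    h * d                      ∎)

r*h+[h∸e]≡c+f : ∀ r {h} c f {e} → c + (f + e) ≡ suc r * h → e ≤ h → r * h + (h ∸ e) ≡ c + f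
r*h+[h∸e]≡c+f r {h} c f {e} total e≤h = +-cancelʳ-≡ e _ _ (begin
  r * h + (h ∸ e) + e ≡⟨ +-assoc (r * h) (h ∸ e) e ⟩
  r * h + (h ∸ e + e) ≡⟨ cong (r * h +_) (m∸n+n≡m e≤h) ⟩
  r * h + h           ≡⟨ +-comm (r * h) h ⟩
  suc r * h           ≡⟨ total ⟨
  c + (f + e)         ≡⟨ +-assoc c f e ⟨
  c + f + e           ∎)
  where open ≡-Reasoning

module _ {a ℓ : Level} (G : AbelianGroup a ℓ) where
  open AbelianGroup G
  open Sumsets G
  open import Algebra.Properties.Monoid.Mult monoid using (×-homo-+; ×-congˡ) renaming (_×_ to _·_)
  open import Algebra.Properties.CommutativeSemigroup commutativeSemigroup
    using (interchange; xy∙z≈xz∙y; xy∙z≈y∙xz; x∙yz≈y∙xz)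
  open import Algebra.Properties.AbelianGroup G using (xyx⁻¹≈y)
  open import Relation.Binary.Reasoning.Setoid setoid

  InSumset : ℕ → List Carrier → Carrier → Set (a ⊔ ℓ)
  InSumset h A x = Σ (Vec Carrier h) λ xs → All (_∈ A) xs × vsum xs ≈ x

  ApproxGroup : List Carrier → ℕ → ℕ → Set (a ⊔ ℓ)
  ApproxGroup A r ℓ′ = (h : ℕ) → Σ (List Carrier) λ X →
    length X ≤ ℓ′ × ⊆Translates (InSumset (r * h) A) X (InSumset h A)

  lincomb : (A : List Carrier) → Vec ℕ (length A) → Carrier
  lincomb []      []      = ε
  lincomb (y ∷ A) (n ∷ c) = n · y ∙ lincomb A c

  lincomb-zipWith-+ : ∀ A (u v : Vec ℕ (length A)) →
    lincomb A (zipWith _+_ u v) ≈ lincomb A u ∙ lincomb A v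
  lincomb-zipWith-+ []      []      []      = sym (identityˡ ε)
  lincomb-zipWith-+ (y ∷ A) (m ∷ u) (n ∷ v) = begin
    (m + n) · y ∙ lincomb A (zipWith _+_ u v)     ≈⟨ ∙-cong (×-homo-+ y m n) (lincomb-zipWith-+ A u v) ⟩
    (m · y ∙ n · y) ∙ (lincomb A u ∙ lincomb A v) ≈⟨ interchange _ _ _ _ ⟩
    (m · y ∙ lincomb A u) ∙ (n · y ∙ lincomb A v) ∎

  lincomb-replicate-0 : ∀ A → lincomb A (replicate (length A) 0) ≈ ε
  lincomb-replicate-0 []      = refl
  lincomb-replicate-0 (y ∷ A) = trans (identityˡ _) (lincomb-replicate-0 A)

  incrementAt : ∀ {x A} → x ∈ A → Vec ℕ (length A) → Vec ℕ (length A)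
  incrementAt (here _)  (n ∷ c) = suc n ∷ c
  incrementAt (there p) (n ∷ c) = n ∷ incrementAt p c

  sum-incrementAt : ∀ {x A} (p : x ∈ A) c → sum (incrementAt p c) ≡ suc (sum c)
  sum-incrementAt (here _)  (n ∷ c) = ≡.refl
  sum-incrementAt (there p) (n ∷ c) = ≡.trans (cong (n +_) (sum-incrementAt p c)) (+-suc n (sum c))

  lincomb-incrementAt : ∀ {x A} (p : x ∈ A) c → lincomb A (incrementAt p c) ≈ x ∙ lincomb A c
  lincomb-incrementAt {x} {y ∷ A} (here x≈y) (n ∷ c) = begin
    (y ∙ n · y) ∙ lincomb A c ≈⟨ assoc _ _ _ ⟩
    y ∙ (n · y ∙ lincomb A c) ≈⟨ ∙-congʳ x≈y ⟨
    x ∙ (n · y ∙ lincomb A c) ∎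
  lincomb-incrementAt {x} {y ∷ A} (there p) (n ∷ c) = begin
    n · y ∙ lincomb A (incrementAt p c) ≈⟨ ∙-congˡ (lincomb-incrementAt p c) ⟩
    n · y ∙ (x ∙ lincomb A c)           ≈⟨ x∙yz≈y∙xz _ _ _ ⟩
    x ∙ (n · y ∙ lincomb A c)           ∎

  multiplicities : ∀ {A m} {xs : Vec Carrier m} → All (_∈ A) xs →
    Σ (Vec ℕ (length A)) λ c → sum c ≡ m × vsum xs ≈ lincomb A c
  multiplicities {A} [] =
    replicate (length A) 0 , sum-replicate-0 (length A) , sym (lincomb-replicate-0 A)
  multiplicities {A} {xs = x ∷ xs} (p ∷ ps) =
    let c , Σc≡m , xs≈c = multiplicities ps
    in incrementAt p c , ≡.trans (sum-incrementAt p c) (cong suc Σc≡m) , (begin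
      x ∙ vsum xs                ≈⟨ ∙-congˡ xs≈c ⟩
      x ∙ lincomb A c            ≈⟨ lincomb-incrementAt p c ⟨
      lincomb A (incrementAt p c) ∎)

  add-copies : ∀ {y A m x} n → InSumset m A x → InSumset (n + m) (y ∷ A) (n · y ∙ x)
  add-copies zero    (xs , ps , xs≈x) = xs , All.map there ps , trans xs≈x (sym (identityˡ _))
  add-copies {y} (suc n) s =
    let xs , ps , xs≈ = add-copies n s
    in y ∷ xs , here refl ∷ ps , trans (∙-congˡ xs≈) (sym (assoc _ _ _))

  realise : ∀ A (c : Vec ℕ (length A)) → InSumset (sum c) A (lincomb A c)
  realise []      []      = [] , [] , refl
  realise (y ∷ A) (n ∷ c) = add-copies n (realise A c)

  -- Here suc r is the r of the theorem.
  module SingleSet (r h : ℕ) (b : Carrier) (B : List Carrier) where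

    d : ℕ
    d = length B

    offset : Vec ℕ d → Carrier
    offset n = ((r * h) · b ∙ lincomb B f) ∙ (sum f · b) ⁻¹
      where f = gridPoint h d n

    offsets : List Carrier
    offsets = List.map offset (simplex d (suc r * d))

    length-offsets : length offsets ≡ (suc (suc r) * d) C d
    length-offsets = ≡.trans (length-map offset (simplex d (suc r * d)))
      (≡.trans (length-simplex d (suc r * d)) (cong (_C d) (+-comm (suc r * d) d)))

    split-counts : ∀ c₀ (c : Vec ℕ d) → c₀ + sum c ≡ suc r * h →
      ∃ λ n → n ∈ₚ simplex d (suc r * d) × ∃ λ (e : Vec ℕ (suc d)) →
        sum e ≡ h × lincomb (b ∷ B) (c₀ ∷ c) ≈ offset n ∙ lincomb (b ∷ B) e
    split-counts c₀ c total =
      let Σc≤rh = ≤-trans (m≤n+m (sum c) c₀) (≤-reflexive total)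
          n , e , n∈ , c≡f+e , Σe≤h = grid-approximation (suc r) h d c Σc≤rh
          f  = gridPoint h d n
          e₀ = h ∸ sum e
          Σc≡Σf+Σe = ≡.trans (cong sum c≡f+e) (sum-zipWith-+ f e)
          balance = r*h+[h∸e]≡c+f r c₀ (sum f) (≡.trans (cong (c₀ +_) (≡.sym Σc≡Σf+Σe)) total) Σe≤h
      in n , n∈ , e₀ ∷ e , m∸n+n≡m Σe≤h , (begin
        c₀ · b ∙ lincomb B c                 ≈⟨ ∙-congˡ (reflexive (cong (lincomb B) c≡f+e)) ⟩
        c₀ · b ∙ lincomb B (zipWith _+_ f e) ≈⟨ ∙-congˡ (lincomb-zipWith-+ B f e) ⟩
        c₀ · b ∙ (lincomb B f ∙ lincomb B e) ≈⟨ rearrange (begin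
          (r * h) · b ∙ e₀ · b ≈⟨ ×-homo-+ b (r * h) e₀ ⟨
          (r * h + e₀) · b     ≈⟨ ×-congˡ balance ⟩
          (c₀ + sum f) · b     ≈⟨ ×-homo-+ b c₀ (sum f) ⟩
          c₀ · b ∙ sum f · b   ∎) ⟩
        offset n ∙ (e₀ · b ∙ lincomb B e)    ∎)
      where
      rearrange : ∀ {x u v p k w} → p ∙ k ≈ x ∙ w → x ∙ (u ∙ v) ≈ ((p ∙ u) ∙ w ⁻¹) ∙ (k ∙ v)
      rearrange {x} {u} {v} {p} {k} {w} pk≈xw = sym (begin
        ((p ∙ u) ∙ w ⁻¹) ∙ (k ∙ v) ≈⟨ xy∙z≈xz∙y _ _ _ ⟩
        ((p ∙ u) ∙ (k ∙ v)) ∙ w ⁻¹ ≈⟨ ∙-congʳ (interchange _ _ _ _) ⟩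
        ((p ∙ k) ∙ (u ∙ v)) ∙ w ⁻¹ ≈⟨ ∙-congʳ (∙-congʳ pk≈xw) ⟩
        ((x ∙ w) ∙ (u ∙ v)) ∙ w ⁻¹ ≈⟨ ∙-congʳ (xy∙z≈y∙xz _ _ _) ⟩
        (w ∙ (x ∙ (u ∙ v))) ∙ w ⁻¹ ≈⟨ xyx⁻¹≈y _ _ ⟩
        x ∙ (u ∙ v)                ∎)

    ⊆offsets+sumset : ⊆Translates (InSumset (suc r * h) (b ∷ B)) offsets (InSumset h (b ∷ B))
    ⊆offsets+sumset y (xs , ps , xs≈y) with multiplicities ps
    ... | c₀ ∷ c , total , xs≈c =
      let n , n∈ , e , Σe≡h , c≈ = split-counts c₀ c total
      in offset n , lincomb (b ∷ B) e ,
         SetoidMembership.∈-map⁺ (≡.setoid (Vec ℕ d)) setoid (reflexive ∘ cong offset) n∈ ,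
         subst (λ m → InSumset m (b ∷ B) (lincomb (b ∷ B) e)) Σe≡h (realise (b ∷ B) e) ,
         trans (sym xs≈y) (trans xs≈c c≈)

  nonempty-approxGroup : ∀ r (A : List Carrier) → A ≢ [] →
    ApproxGroup A (suc r) ((suc (suc r) * (length A ∸ 1)) C (length A ∸ 1))
  nonempty-approxGroup r []      A≢[] _ = ⊥-elim (A≢[] ≡.refl)
  nonempty-approxGroup r (b ∷ B) _    h = offsets , ≤-reflexive length-offsets , ⊆offsets+sumset
    where open SingleSet r h b B

  sumsetList : (q : ℕ) → (Fin q → List Carrier) → List Carrier
  sumsetList zero    X = ε ∷ []
  sumsetList (suc q) X = cartesianProductWith _∙_ (X zero) (sumsetList q (X ∘ suc))

  length-sumsetList≤ : ∀ q (X : Fin q → List Carrier) (ℓs : Fin q → ℕ) →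
    (∀ i → length (X i) ≤ ℓs i) → length (sumsetList q X) ≤ ∏ q ℓs
  length-sumsetList≤ zero    X ℓs _     = ≤-refl
  length-sumsetList≤ (suc q) X ℓs |X|≤ℓ =
    ≤-trans (≤-reflexive (length-cartesianProductWith _∙_ (X zero) (sumsetList q (X ∘ suc))))
      (*-mono-≤ (|X|≤ℓ zero) (length-sumsetList≤ q (X ∘ suc) (ℓs ∘ suc) (|X|≤ℓ ∘ suc)))

  ⊆Translates-multi : ∀ q (h h′ : Fin q → ℕ) (𝒜 X : Fin q → List Carrier) →
    (∀ i → ⊆Translates (InSumset (h′ i) (𝒜 i)) (X i) (InSumset (h i) (𝒜 i))) →
    ⊆Translates (InMultiSum q h′ 𝒜) (sumsetList q X) (InMultiSum q h 𝒜)
  ⊆Translates-multi zero    h h′ 𝒜 X _     y (_ , _ , ε≈y) =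
    ε , ε , here refl , ((λ ()) , (λ ()) , refl) , trans (sym ε≈y) (sym (identityˡ ε))
  ⊆Translates-multi (suc q) h h′ 𝒜 X ⊆X+ y (xs , ps , Σxs≈y) =
    let x₀ , z₀ , x₀∈ , (e₀ , pe₀ , e₀≈z₀) , xs₀≈ =
          ⊆X+ zero (vsum (xs zero)) (xs zero , ps zero , refl)
        x′ , z′ , x′∈ , (e′ , pe′ , e′≈z′) , xs′≈ =
          ⊆Translates-multi q (h ∘ suc) (h′ ∘ suc) (𝒜 ∘ suc) (X ∘ suc) (⊆X+ ∘ suc)
            _ (xs ∘ suc , ps ∘ suc , refl)
    in x₀ ∙ x′ , z₀ ∙ z′ ,
       SetoidMembership.∈-cartesianProductWith⁺ setoid setoid setoid ∙-cong x₀∈ x′∈ ,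
       ((λ { zero → e₀ ; (suc i) → e′ i }) , (λ { zero → pe₀ ; (suc i) → pe′ i }) ,
        ∙-cong e₀≈z₀ e′≈z′) ,
       trans (sym Σxs≈y) (trans (∙-cong xs₀≈ xs′≈) (interchange _ _ _ _))

  chromatic-product : ∀ q (𝒜 : Fin q → List Carrier) (ℓs : Fin q → ℕ) r →
    (∀ i → ApproxGroup (𝒜 i) r (ℓs i)) → ChromaticApproxGroup q 𝒜 r (∏ q ℓs)
  chromatic-product q 𝒜 ℓs r approx h =
    sumsetList q X ,
    length-sumsetList≤ q X ℓs (λ i → proj₁ (proj₂ (approx i (h i)))) ,
    ⊆Translates-multi q h (scale r h) 𝒜 X (λ i → proj₂ (proj₂ (approx i (h i))))
    where
    X : Fin q → List Carrier
    X i = proj₁ (approx i (h i))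

theorem1p12 : {c ℓ : Level} (G : AbelianGroup c ℓ) (q : ℕ)
    (𝒜 : Fin q → List (AbelianGroup.Carrier G))
    → ((i : Fin q) → Unique (AbelianGroup.setoid G) (𝒜 i))
    → ((i : Fin q) → 𝒜 i ≢ [])
    → (r : ℕ) → 1 ≤ r
    → Sumsets.ChromaticApproxGroup G q 𝒜 r (bound q (λ i → length (𝒜 i)) r)
theorem1p12 G q 𝒜 _ 𝒜≢[] (suc r) _ =
  chromatic-product G q 𝒜 _ (suc r) (λ i → nonempty-approxGroup G r (𝒜 i) (𝒜≢[] i))
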